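{- Let $G$ be a bipartite graph with color classes $A$ and $B$, where $|A| = |B| = n$. Let $k$ be an integer with $k < \delta(G)$ and let $D = \frac{\Delta(G) - k}{\delta(G) - k}$. Suppose that (i) $e(X,Y) \geq k|X||Y|/n$ for all $X \subseteq A$ and $Y \subseteq B$ with $|X|,|Y| \geq n/140$, and (ii) $e(X,Y) \leq \min\{|X|,|Y|\} \cdot k$ for all $X \subseteq A$ and $Y \subseteq B$ with $|X|,|Y| \leq n/140$ and $1/D \leq |X|/|Y| \leq D$. Then $G$ contains a $k$-factor (a spanning $k$-regular subgraph).
   Context: $e(X,Y)$ denotes the number of edges of $G$ with one endpoint in $X$ and the other in $Y$; $\delta(G)$ and $\Delta(G)$ are the minimum and maximum degree of $G$. -}

module Defs where

open import Data.Bool using (Bool; true; false; if_then_else_; _∧_)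
open import Data.Nat using (ℕ; _≤_)
open import Data.Fin using (Fin)
open import Data.Fin.Subset using (Subset; ∣_∣)
open import Data.Vec using (tabulate; lookup)
open import Data.List using (List; allFin; map)
open import Data.Nat.ListAction using (sum)
open import Data.Product using (Σ; ∃; _×_)
open import Data.Sum using (_⊎_)
open import Relation.Binary.PropositionalEquality using (_≡_)

-- A (simple) bipartite graph with colour classes A = Fin n and B = Fin n:
-- G a b ≡ true iff a ∈ A is adjacent to b ∈ B.
BipGraph : ℕ → Set
BipGraph n = Fin n → Fin n → Bool

degA : ∀ {n} → BipGraph n → Fin n → ℕ
degA G a = ∣ tabulate (G a) ∣

degB : ∀ {n} → BipGraph n → Fin n → ℕ
degB G b = ∣ tabulate (λ a → G a b) ∣

e : ∀ {n} → BipGraph n → Subset n → Subset n → ℕ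
e {n} G X Y =
  sum (map (λ a → sum (map (λ b → if lookup X a ∧ lookup Y b ∧ G a b then 1 else 0)
                           (allFin n)))
           (allFin n))

IsMinDegree : ∀ {n} → BipGraph n → ℕ → Set
IsMinDegree G δ =
  (∀ a → δ ≤ degA G a) × (∀ b → δ ≤ degB G b) ×
  ((∃ λ a → degA G a ≡ δ) ⊎ (∃ λ b → degB G b ≡ δ))

IsMaxDegree : ∀ {n} → BipGraph n → ℕ → Set
IsMaxDegree G Δ =
  (∀ a → degA G a ≤ Δ) × (∀ b → degB G b ≤ Δ) ×
  ((∃ λ a → degA G a ≡ Δ) ⊎ (∃ λ b → degB G b ≡ Δ))

HasKFactor : ∀ {n} → BipGraph n → ℕ → Set
HasKFactor {n} G k =
  Σ (BipGraph n) λ F →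
    (∀ a b → F a b ≡ true → G a b ≡ true) ×
    (∀ a → degA F a ≡ k) × (∀ b → degB F b ≡ k)

module Submission where

-- The route is through Hall's theorem for degree-constrained subgraphs: G has a subgraph in
-- which each a ∈ A has degree r(a) and each b ∈ B degree at most c(b) as soon as every X ⊆ A
-- satisfies ∑_{a∈X} r(a) ≤ ∑_b min(c(b), |N(b) ∩ X|).  It is proved by induction on ∑ r:
-- a tight set X splits the problem into the demand on X and the demand off X against the
-- leftover capacity; if there is none, an edge ab can be deleted while r(a), c(b) drop by one.
-- For r = c = k the condition reads k|X| ≤ e(X,Y) + k|B ∖ Y| (the deficiency bound).  It
-- follows from (i) if X, Y are large.  If X is small, cutting B ∖ Y into pieces of size |X|
-- and using (ii) gives e(X, B ∖ Y) ≤ (δ-k)|X| + k|B ∖ Y|, which together with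
-- δ|X| ≤ e(X,Y) + e(X, B ∖ Y) yields the bound; small Y is the transposed argument.  As
-- |A| = |B|, a subgraph with A-degrees k and B-degrees at most k is k-regular.

open import Defs

open import Data.Bool using (Bool; true; false; not; _∧_; _∨_; if_then_else_)
open import Data.Bool.Properties using (∧-zeroʳ; ∧-identityʳ; ∨-identityʳ)
open import Data.Nat using (ℕ; zero; suc; _+_; _*_; _∸_; _⊓_; _≤_; _<_; z≤n; s≤s; s≤s⁻¹)
open import Data.Nat.Properties hiding (_≟_)
open import Data.Nat.Induction using (<-rec)
open import Data.Nat.Tactic.RingSolver using (solve-∀)
open import Data.Nat.ListAction using () renaming (sum to listSum)
open import Data.Fin using (Fin; zero; suc; _≟_)
import Data.Fin.Properties as Fin
open import Data.Fin.Subset using (Subset; ∣_∣; ⊥; ⁅_⁆; ∁; _∩_; _∪_)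
open import Data.Fin.Subset.Properties using (∣p∣≤n; ∣∁p∣≡n∸∣p∣; anySubset?)
open import Data.Vec using ([]; _∷_; lookup; tabulate)
open import Data.Vec.Properties using (lookup-map; lookup-zipWith; lookup∘tabulate)
open import Data.List using (allFin)
import Data.List as List
open import Data.List.Properties using (map-tabulate)
open import Data.Product using (∃; _×_; _,_)
open import Data.Sum using (inj₁; inj₂)
open import Function using (_∘_)
open import Relation.Nullary using (¬_; Dec; does; yes; no; contradiction)
open import Relation.Nullary.Decidable using (_×-dec_; dec-true; dec-false)
open import Relation.Binary.PropositionalEquality
open import Algebra.Properties.Semiring.Sum +-*-semiring
  using (∑-distrib-+; ∑-comm; sum-cong-≗; *-distribˡ-sum; sum-replicate-zero)
  renaming (sum to ∑)

𝟙 : Bool → ℕ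
𝟙 true  = 1
𝟙 false = 0

∑-mono : ∀ {n} {f g : Fin n → ℕ} → (∀ i → f i ≤ g i) → ∑ f ≤ ∑ g
∑-mono {zero}  f≤g = z≤n
∑-mono {suc n} f≤g = +-mono-≤ (f≤g zero) (∑-mono (f≤g ∘ suc))

∑-mono-< : ∀ {n} {f g : Fin n → ℕ} → (∀ i → f i ≤ g i) → ∀ a → f a < g a → ∑ f < ∑ g
∑-mono-< f≤g zero    fa<ga = +-mono-<-≤ fa<ga (∑-mono (f≤g ∘ suc))
∑-mono-< f≤g (suc a) fa<ga = +-mono-≤-< (f≤g zero) (∑-mono-< (f≤g ∘ suc) a fa<ga)

∑-rigid : ∀ {n} {f g : Fin n → ℕ} → (∀ i → f i ≤ g i) → ∑ g ≤ ∑ f → ∀ i → f i ≡ g i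
∑-rigid f≤g ∑g≤∑f i with m≤n⇒m<n∨m≡n (f≤g i)
... | inj₂ fi≡gi = fi≡gi
... | inj₁ fi<gi = contradiction (∑-mono-< f≤g i fi<gi) (≤⇒≯ ∑g≤∑f)

∑-zero : ∀ {n} {f : Fin n → ℕ} → ∑ f ≡ 0 → ∀ i → f i ≡ 0
∑-zero {n} ∑f≡0 i = sym (∑-rigid (λ _ → z≤n) (≤-reflexive (trans ∑f≡0 (sym (sum-replicate-zero n)))) i)

∑-positive : ∀ {n} (f : Fin n → ℕ) → 0 < ∑ f → ∃ λ i → 0 < f i
∑-positive {suc n} f 0<∑f with f zero in eq
... | suc _ = zero , subst (0 <_) (sym eq) (s≤s z≤n)
... | zero  = let i , 0<fi = ∑-positive (f ∘ suc) 0<∑f in suc i , 0<fi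

∑-exchange : ∀ {n} (a : Fin n) (f g : Fin n → ℕ) → (∀ i → i ≢ a → f i ≡ g i) →
             ∑ f + g a ≡ ∑ g + f a
∑-exchange {suc n} zero f g f≗g = begin
  f zero + ∑ (f ∘ suc) + g zero ≡⟨ cong (λ s → f zero + s + g zero) (sum-cong-≗ (λ i → f≗g (suc i) λ ())) ⟩
  f zero + ∑ (g ∘ suc) + g zero ≡⟨ outer-swap (f zero) _ (g zero) ⟩
  g zero + ∑ (g ∘ suc) + f zero ∎
  where
  open ≡-Reasoning
  outer-swap : ∀ x s y → x + s + y ≡ y + s + x
  outer-swap = solve-∀
∑-exchange {suc n} (suc a) f g f≗g = begin
  f zero + ∑ (f ∘ suc) + g (suc a)   ≡⟨ +-assoc (f zero) _ _ ⟩
  f zero + (∑ (f ∘ suc) + g (suc a)) ≡⟨ cong₂ _+_ (f≗g zero λ ()) (∑-exchange a (f ∘ suc) (g ∘ suc)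
                                          λ i i≢a → f≗g (suc i) (i≢a ∘ Fin.suc-injective)) ⟩
  g zero + (∑ (g ∘ suc) + f (suc a)) ≡⟨ +-assoc (g zero) _ _ ⟨
  g zero + ∑ (g ∘ suc) + f (suc a)   ∎
  where open ≡-Reasoning

∑-suc-at : ∀ {n} (a : Fin n) (f g : Fin n → ℕ) → (∀ i → i ≢ a → f i ≡ g i) →
           g a ≡ suc (f a) → ∑ g ≡ suc (∑ f)
∑-suc-at a f g f≗g ga≡1+fa = +-cancelʳ-≡ (f a) _ _ (begin
  ∑ g + f a       ≡⟨ ∑-exchange a f g f≗g ⟨
  ∑ f + g a       ≡⟨ cong (∑ f +_) ga≡1+fa ⟩
  ∑ f + suc (f a) ≡⟨ +-suc (∑ f) (f a) ⟩
  suc (∑ f) + f a ∎)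
  where open ≡-Reasoning

∑-≤-suc-at : ∀ {n} (a : Fin n) (f g : Fin n → ℕ) → (∀ i → i ≢ a → f i ≡ g i) →
             g a ≤ suc (f a) → ∑ g ≤ suc (∑ f)
∑-≤-suc-at a f g f≗g ga≤1+fa = +-cancelʳ-≤ (f a) _ _ (begin
  ∑ g + f a       ≡⟨ ∑-exchange a f g f≗g ⟨
  ∑ f + g a       ≤⟨ +-monoʳ-≤ (∑ f) ga≤1+fa ⟩
  ∑ f + suc (f a) ≡⟨ +-suc (∑ f) (f a) ⟩
  suc (∑ f) + f a ∎)
  where open ≤-Reasoning

_↾_ : ∀ {n} → (Fin n → ℕ) → Subset n → Fin n → ℕ
(w ↾ X) i = 𝟙 (lookup X i) * w i

weight : ∀ {n} → (Fin n → ℕ) → Subset n → ℕ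
weight w X = ∑ (w ↾ X)

∣∣-as-∑ : ∀ {n} (X : Subset n) → ∣ X ∣ ≡ ∑ (𝟙 ∘ lookup X)
∣∣-as-∑ []          = refl
∣∣-as-∑ (true ∷ X)  = cong suc (∣∣-as-∑ X)
∣∣-as-∑ (false ∷ X) = ∣∣-as-∑ X

∣tabulate∣ : ∀ {n} (f : Fin n → Bool) → ∣ tabulate f ∣ ≡ ∑ (𝟙 ∘ f)
∣tabulate∣ f = trans (∣∣-as-∑ (tabulate f)) (sum-cong-≗ (cong 𝟙 ∘ lookup∘tabulate f))

weight-const : ∀ {n} (c : ℕ) (X : Subset n) → weight (λ _ → c) X ≡ c * ∣ X ∣
weight-const c X = begin
  ∑ (λ i → 𝟙 (lookup X i) * c) ≡⟨ sum-cong-≗ (λ i → *-comm (𝟙 (lookup X i)) c) ⟩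
  ∑ (λ i → c * 𝟙 (lookup X i)) ≡⟨ *-distribˡ-sum c (𝟙 ∘ lookup X) ⟨
  c * ∑ (𝟙 ∘ lookup X)         ≡⟨ cong (c *_) (∣∣-as-∑ X) ⟨
  c * ∣ X ∣                     ∎
  where open ≡-Reasoning

weight-mono : ∀ {n} {v w : Fin n → ℕ} → (∀ i → v i ≤ w i) → ∀ X → weight v X ≤ weight w X
weight-mono v≤w X = ∑-mono (λ i → *-monoʳ-≤ (𝟙 (lookup X i)) (v≤w i))

weight-+ : ∀ {n} (v w : Fin n → ℕ) X → weight (λ i → v i + w i) X ≡ weight v X + weight w X
weight-+ v w X = trans (sum-cong-≗ (λ i → *-distribˡ-+ (𝟙 (lookup X i)) (v i) (w i)))
                       (∑-distrib-+ (v ↾ X) (w ↾ X))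

module Bracket where
  ∧-split : ∀ x d w → 𝟙 x * w ≡ 𝟙 (x ∧ d) * w + 𝟙 (x ∧ not d) * w
  ∧-split true  true  w = sym (+-identityʳ _)
  ∧-split true  false w = refl
  ∧-split false d     w = refl

  ∨-split : ∀ x y w → 𝟙 (x ∨ y) * w ≡ 𝟙 (x ∧ not y) * w + 𝟙 y * w
  ∨-split true  true  w = refl
  ∨-split true  false w = sym (+-identityʳ _)
  ∨-split false y     w = refl

  ∧-restrict : ∀ x y w → 𝟙 x * (𝟙 y * w) ≡ 𝟙 (x ∧ y) * w
  ∧-restrict true  y w = +-identityʳ _
  ∧-restrict false y w = refl

  ≤-self : ∀ x w → 𝟙 x * w ≤ w
  ≤-self true  w = ≤-reflexive (+-identityʳ w)
  ≤-self false w = z≤n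

  complement : ∀ x w → 𝟙 x * w + 𝟙 (not x) * w ≡ w
  complement true  w = trans (+-identityʳ _) (+-identityʳ w)
  complement false w = +-identityʳ w

  ∧-≤ : ∀ x y w → 𝟙 (x ∧ y) * w ≤ 𝟙 x * w
  ∧-≤ true  y w = ≤-trans (≤-self y w) (≤-reflexive (sym (*-identityˡ w)))
  ∧-≤ false y w = z≤n

open Bracket

lookup-∩ : ∀ {n} (X Y : Subset n) i → lookup (X ∩ Y) i ≡ (lookup X i ∧ lookup Y i)
lookup-∩ X Y i = lookup-zipWith _∧_ i X Y

lookup-∪ : ∀ {n} (X Y : Subset n) i → lookup (X ∪ Y) i ≡ (lookup X i ∨ lookup Y i)
lookup-∪ X Y i = lookup-zipWith _∨_ i X Y

lookup-∁ : ∀ {n} (X : Subset n) i → lookup (∁ X) i ≡ not (lookup X i)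
lookup-∁ X i = lookup-map i not X

weight-split : ∀ {n} (w : Fin n → ℕ) (X D : Subset n) →
               weight w X ≡ weight w (X ∩ D) + weight w (X ∩ ∁ D)
weight-split w X D = trans (sum-cong-≗ pointwise) (∑-distrib-+ (w ↾ (X ∩ D)) (w ↾ (X ∩ ∁ D)))
  where
  pointwise : ∀ i → (w ↾ X) i ≡ (w ↾ (X ∩ D)) i + (w ↾ (X ∩ ∁ D)) i
  pointwise i rewrite lookup-∩ X D i | lookup-∩ X (∁ D) i | lookup-∁ D i =
    ∧-split (lookup X i) (lookup D i) (w i)

weight-∪ : ∀ {n} (w : Fin n → ℕ) (X Y : Subset n) →
           weight w (X ∪ Y) ≡ weight w (X ∩ ∁ Y) + weight w Y
weight-∪ w X Y = trans (sum-cong-≗ pointwise) (∑-distrib-+ (w ↾ (X ∩ ∁ Y)) (w ↾ Y))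
  where
  pointwise : ∀ i → (w ↾ (X ∪ Y)) i ≡ (w ↾ (X ∩ ∁ Y)) i + (w ↾ Y) i
  pointwise i rewrite lookup-∪ X Y i | lookup-∩ X (∁ Y) i | lookup-∁ Y i =
    ∨-split (lookup X i) (lookup Y i) (w i)

weight-complement : ∀ {n} (w : Fin n → ℕ) (X : Subset n) → weight w X + weight w (∁ X) ≡ ∑ w
weight-complement w X = trans (sym (∑-distrib-+ (w ↾ X) (w ↾ ∁ X))) (sum-cong-≗ λ i →
  trans (cong (λ x → (w ↾ X) i + 𝟙 x * w i) (lookup-∁ X i)) (complement (lookup X i) (w i)))

weight-restrict : ∀ {n} (w : Fin n → ℕ) (X Y : Subset n) → weight (w ↾ Y) X ≡ weight w (X ∩ Y)
weight-restrict w X Y = sum-cong-≗ λ i →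
  trans (∧-restrict (lookup X i) (lookup Y i) (w i)) (cong (λ x → 𝟙 x * w i) (sym (lookup-∩ X Y i)))

weight-∩ : ∀ {n} (w : Fin n → ℕ) (X Y : Subset n) → weight w (X ∩ Y) ≤ weight w X
weight-∩ w X Y = ∑-mono λ i →
  subst (λ x → 𝟙 x * w i ≤ _) (sym (lookup-∩ X Y i)) (∧-≤ (lookup X i) (lookup Y i) (w i))

weight-≤-∑ : ∀ {n} (w : Fin n → ℕ) (X : Subset n) → weight w X ≤ ∑ w
weight-≤-∑ w X = ∑-mono λ i → ≤-self (lookup X i) (w i)

weight-⊥ : ∀ {n} (w : Fin n → ℕ) → weight w (⊥ {n}) ≡ 0
weight-⊥ {zero}  w = refl
weight-⊥ {suc n} w = weight-⊥ (w ∘ suc)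

weight-⁅⁆ : ∀ {n} (w : Fin n → ℕ) (a : Fin n) → weight w ⁅ a ⁆ ≡ w a
weight-⁅⁆ w zero    = trans (cong (w zero + 0 +_) (weight-⊥ (w ∘ suc))) (trans (+-identityʳ _) (+-identityʳ _))
weight-⁅⁆ w (suc a) = weight-⁅⁆ (w ∘ suc) a

weight-swap : ∀ {m n} (g : Fin m → Fin n → ℕ) (X : Subset m) (Y : Subset n) →
              weight (λ a → weight (g a) Y) X ≡ weight (λ b → weight (λ a → g a b) X) Y
weight-swap {m} {n} g X Y = begin
  ∑ (λ a → x a * ∑ (λ b → y b * g a b))           ≡⟨ sum-cong-≗ (λ a → *-distribˡ-sum (x a) (λ b → y b * g a b)) ⟩
  ∑ (λ a → ∑ {n} (λ b → x a * (y b * g a b)))     ≡⟨ sum-cong-≗ (λ a → sum-cong-≗ (λ b → x-y-swap (x a) (y b) (g a b))) ⟩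
  ∑ (λ a → ∑ {n} (λ b → y b * (x a * g a b)))     ≡⟨ ∑-comm (λ a b → y b * (x a * g a b)) ⟩
  ∑ (λ b → ∑ {m} (λ a → y b * (x a * g a b)))     ≡⟨ sum-cong-≗ (λ b → *-distribˡ-sum (y b) (λ a → x a * g a b)) ⟨
  ∑ (λ b → y b * ∑ (λ a → x a * g a b))           ∎
  where
  open ≡-Reasoning
  x = 𝟙 ∘ lookup X
  y = 𝟙 ∘ lookup Y
  x-y-swap : ∀ p q r → p * (q * r) ≡ q * (p * r)
  x-y-swap = solve-∀

Graph : ℕ → ℕ → Set
Graph m n = Fin m → Fin n → Bool

deg₁ : ∀ {m n} → Graph m n → Fin m → ℕ
deg₁ F a = ∑ λ b → 𝟙 (F a b)

deg₂ : ∀ {m n} → Graph m n → Fin n → ℕ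
deg₂ F b = ∑ λ a → 𝟙 (F a b)

nbrs : ∀ {m n} → Graph m n → Subset m → Fin n → ℕ
nbrs G X b = weight (λ a → 𝟙 (G a b)) X

supply : ∀ {m n} → Graph m n → (Fin n → ℕ) → Subset m → ℕ
supply G c X = ∑ λ b → c b ⊓ nbrs G X b

HallCondition : ∀ {m n} → Graph m n → (Fin m → ℕ) → (Fin n → ℕ) → Set
HallCondition G r c = ∀ X → weight r X ≤ supply G c X

record Factor {m n} (G : Graph m n) (r : Fin m → ℕ) (c : Fin n → ℕ) : Set where
  field
    graph  : Graph m n
    ⊆G     : ∀ a b → graph a b ≡ true → G a b ≡ true
    deg₁≡r : ∀ a → deg₁ graph a ≡ r a
    deg₂≤c : ∀ b → deg₂ graph b ≤ c b

𝟙≡0 : ∀ {x} → 𝟙 x ≡ 0 → x ≡ false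
𝟙≡0 {false} _ = refl

𝟙-if : ∀ x y z → 𝟙 (if x then y else z) ≤ 𝟙 y + 𝟙 z
𝟙-if true  y z = m≤m+n (𝟙 y) (𝟙 z)
𝟙-if false y z = m≤n+m (𝟙 z) (𝟙 y)

isolated : ∀ {m n} (F : Graph m n) a b → deg₁ F a ≡ 0 → F a b ≡ false
isolated F a b deg≡0 = 𝟙≡0 (∑-zero deg≡0 b)

supply-∩ : ∀ {m n} (G : Graph m n) c (X Y : Subset m) → supply G c (X ∩ Y) ≤ supply G c X
supply-∩ G c X Y = ∑-mono λ b → ⊓-monoʳ-≤ (c b) (weight-∩ (λ a → 𝟙 (G a b)) X Y)

factor-weaken : ∀ {m n} {G : Graph m n} {r c c'} → (∀ b → c b ≤ c' b) → Factor G r c → Factor G r c'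
factor-weaken c≤c' F = record { Factor F; deg₂≤c = λ b → ≤-trans (Factor.deg₂≤c F b) (c≤c' b) }

-- A factor for the demand restricted to X only has edges at X, so b has at most
-- |N(b) ∩ X| of them.
factor-within : ∀ {m n} {G : Graph m n} {r c} (X : Subset m) →
                Factor G (r ↾ X) c → Factor G (r ↾ X) (λ b → c b ⊓ nbrs G X b)
factor-within {G = G} {r} X F = record
  { Factor F; deg₂≤c = λ b → ⊓-glb (deg₂≤c b) (∑-mono (edge-from-X b)) }
  where
  open Factor F
  edge-from-X : ∀ b a → 𝟙 (graph a b) ≤ 𝟙 (lookup X a) * 𝟙 (G a b)
  edge-from-X b a with lookup X a in Xa | graph a b in Fab
  ... | _     | false = z≤n
  ... | true  | true  rewrite ⊆G a b Fab = ≤-refl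
  ... | false | true  with () ← trans (sym Fab) (isolated graph a b (trans (deg₁≡r a) (cong (λ x → 𝟙 x * r a) Xa)))

factor-glue : ∀ {m n} {G : Graph m n} {r c₀ c₁} (X : Subset m) →
              Factor G (r ↾ X) c₀ → Factor G (r ↾ ∁ X) c₁ → Factor G r (λ b → c₀ b + c₁ b)
factor-glue {m} {n} {G = G} {r} {c₀} {c₁} X F₀ F₁ = record
  { graph = glued; ⊆G = glued⊆G; deg₁≡r = glued-deg₁; deg₂≤c = glued-deg₂ }
  where
  module F₀ = Factor F₀
  module F₁ = Factor F₁
  glued : Graph m n
  glued a b = if lookup X a then F₀.graph a b else F₁.graph a b
  glued⊆G : ∀ a b → glued a b ≡ true → G a b ≡ true
  glued⊆G a b with lookup X a
  ... | true  = F₀.⊆G a b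
  ... | false = F₁.⊆G a b
  glued-deg₁ : ∀ a → deg₁ glued a ≡ r a
  glued-deg₁ a with lookup X a in Xa
  ... | true  = trans (F₀.deg₁≡r a) (trans (cong (λ x → 𝟙 x * r a) Xa) (*-identityˡ (r a)))
  ... | false = trans (F₁.deg₁≡r a) (trans (cong (λ x → 𝟙 x * r a) (trans (lookup-∁ X a) (cong not Xa)))
                                           (*-identityˡ (r a)))
  glued-deg₂ : ∀ b → deg₂ glued b ≤ c₀ b + c₁ b
  glued-deg₂ b = begin
    deg₂ glued b
      ≤⟨ ∑-mono (λ a → 𝟙-if (lookup X a) (F₀.graph a b) (F₁.graph a b)) ⟩
    ∑ (λ a → 𝟙 (F₀.graph a b) + 𝟙 (F₁.graph a b))
      ≡⟨ ∑-distrib-+ (λ a → 𝟙 (F₀.graph a b)) (λ a → 𝟙 (F₁.graph a b)) ⟩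
    deg₂ F₀.graph b + deg₂ F₁.graph b
      ≤⟨ +-mono-≤ (F₀.deg₂≤c b) (F₁.deg₂≤c b) ⟩
    c₀ b + c₁ b ∎
    where open ≤-Reasoning

hall-restrict : ∀ {m n} {G : Graph m n} {r c} (X : Subset m) →
                HallCondition G r c → HallCondition G (r ↾ X) c
hall-restrict {G = G} {r} {c} X hall Z = begin
  weight (r ↾ X) Z     ≡⟨ weight-restrict r Z X ⟩
  weight r (Z ∩ X)     ≤⟨ hall (Z ∩ X) ⟩
  supply G c (Z ∩ X)   ≤⟨ supply-∩ G c Z X ⟩
  supply G c Z         ∎
  where open ≤-Reasoning

-- The capacity left over at b once X has used as much of it as it can reach.
residual : ∀ {m n} → Graph m n → (Fin n → ℕ) → Subset m → Fin n → ℕ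
residual G c X b = c b ∸ c b ⊓ nbrs G X b

-- Capacity c shared by two groups of x and d neighbours: the second group uses c ⊓ d and the
-- first at most what is left.
⊓-+-≤ : ∀ c x d → c ⊓ (x + d) ≤ (c ∸ c ⊓ d) ⊓ x + c ⊓ d
⊓-+-≤ zero    x d       = z≤n
⊓-+-≤ (suc c) x zero    rewrite +-identityʳ x | +-identityʳ (suc c ⊓ x) = ≤-refl
⊓-+-≤ (suc c) x (suc d) rewrite +-suc x d | +-suc ((c ∸ c ⊓ d) ⊓ x) (c ⊓ d) = s≤s (⊓-+-≤ c x d)

hall-remainder : ∀ {m n} {G : Graph m n} {r c} (X : Subset m) →
                 HallCondition G r c → supply G c X ≤ weight r X →
                 HallCondition G (r ↾ ∁ X) (residual G c X)
hall-remainder {m} {n} {G = G} {r} {c} X hall saturated Z = begin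
  weight (r ↾ ∁ X) Z             ≡⟨ weight-restrict r Z (∁ X) ⟩
  weight r Z'                    ≤⟨ +-cancelʳ-≤ (weight r X) _ _ outside-X ⟩
  supply G (residual G c X) Z'   ≤⟨ supply-∩ G (residual G c X) Z (∁ X) ⟩
  supply G (residual G c X) Z    ∎
  where
  open ≤-Reasoning
  Z' = Z ∩ ∁ X
  outside-X : weight r Z' + weight r X ≤ supply G (residual G c X) Z' + weight r X
  outside-X = begin
    weight r Z' + weight r X          ≡⟨ weight-∪ r Z X ⟨
    weight r (Z ∪ X)                  ≤⟨ hall (Z ∪ X) ⟩
    ∑ {n} (λ b → c b ⊓ nbrs G (Z ∪ X) b)
      ≡⟨ sum-cong-≗ (λ b → cong (c b ⊓_) (weight-∪ (λ a → 𝟙 (G a b)) Z X)) ⟩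
    ∑ {n} (λ b → c b ⊓ (nbrs G Z' b + nbrs G X b))
      ≤⟨ ∑-mono (λ b → ⊓-+-≤ (c b) (nbrs G Z' b) (nbrs G X b)) ⟩
    ∑ {n} (λ b → residual G c X b ⊓ nbrs G Z' b + c b ⊓ nbrs G X b)
      ≡⟨ ∑-distrib-+ (λ b → residual G c X b ⊓ nbrs G Z' b) (λ b → c b ⊓ nbrs G X b) ⟩
    supply G (residual G c X) Z' + supply G c X  ≤⟨ +-monoʳ-≤ _ saturated ⟩
    supply G (residual G c X) Z' + weight r X    ∎

Tight : ∀ {m n} → Graph m n → (Fin m → ℕ) → (Fin n → ℕ) → Subset m → Set
Tight G r c X = 0 < weight r X × weight r X < ∑ r × supply G c X ≤ weight r X

tight? : ∀ {m n} (G : Graph m n) r c X → Dec (Tight G r c X)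
tight? G r c X = (0 <? weight r X) ×-dec (weight r X <? ∑ r) ×-dec (supply G c X ≤? weight r X)

HallBelow : ℕ → ℕ → ℕ → Set
HallBelow m n t = ∀ (G : Graph m n) r c → ∑ r < t → HallCondition G r c → Factor G r c

split-at-tight : ∀ {m n} {G : Graph m n} {r c} (X : Subset m) → HallBelow m n (∑ r) →
                 HallCondition G r c → Tight G r c X → Factor G r c
split-at-tight {G = G} {r} {c} X hall-below hall (0<rX , rX<∑r , saturated) =
  factor-weaken (λ b → ≤-reflexive (m+[n∸m]≡n (m⊓n≤m (c b) (nbrs G X b))))
    (factor-glue X (factor-within X inside) outside)
  where
  inside : Factor G (r ↾ X) c
  inside = hall-below G (r ↾ X) c rX<∑r (hall-restrict {G = G} {r} {c} X hall)
  r∁X<∑r : weight r (∁ X) < ∑ r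
  r∁X<∑r = subst (weight r (∁ X) <_) (weight-complement r X) (m<n+m (weight r (∁ X)) 0<rX)
  outside : Factor G (r ↾ ∁ X) (residual G c X)
  outside = hall-below G (r ↾ ∁ X) (residual G c X) r∁X<∑r (hall-remainder {G = G} {r} {c} X hall saturated)

hall-neighbour : ∀ {m n} {G : Graph m n} {r c} → HallCondition G r c →
                 ∀ a → 0 < r a → ∃ λ b → G a b ≡ true × 0 < c b
hall-neighbour {G = G} {r} {c} hall a 0<ra with ∑-positive (λ b → c b ⊓ 𝟙 (G a b)) 0<supply
  where
  0<supply : 0 < ∑ (λ b → c b ⊓ 𝟙 (G a b))
  0<supply = subst (0 <_) (sum-cong-≗ λ b → cong (c b ⊓_) (weight-⁅⁆ (λ a' → 𝟙 (G a' b)) a))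
               (≤-trans 0<ra (subst (_≤ _) (weight-⁅⁆ r a) (hall ⁅ a ⁆)))
... | b , 0<min with G a b in Gab
...   | true  = b , Gab , ≤-trans 0<min (m⊓n≤m (c b) 1)
...   | false with () ← subst (0 <_) (⊓-zeroʳ (c b)) 0<min

at-or-off : ∀ {n} {P : Fin n → Set} (a : Fin n) → P a → (∀ i → i ≢ a → P i) → ∀ i → P i
at-or-off a Pa Poff i with i ≟ a
... | yes refl = Pa
... | no  i≢a  = Poff i i≢a

edge : ∀ {m n} → Fin m → Fin n → Graph m n
edge a b i j = does (i ≟ a) ∧ does (j ≟ b)

lowerAt : ∀ {n} → Fin n → (Fin n → ℕ) → Fin n → ℕ
lowerAt a f i = f i ∸ 𝟙 (does (i ≟ a))

edge-off-row : ∀ {m n} {a i : Fin m} (b j : Fin n) → i ≢ a → edge a b i j ≡ false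
edge-off-row {a = a} {i} b j i≢a rewrite dec-false (i ≟ a) i≢a = refl

edge-off-column : ∀ {m n} (a i : Fin m) {b j : Fin n} → j ≢ b → edge a b i j ≡ false
edge-off-column a i {b} {j} j≢b rewrite dec-false (j ≟ b) j≢b = ∧-zeroʳ (does (i ≟ a))

edge-at : ∀ {m n} (a : Fin m) (b : Fin n) → edge a b a b ≡ true
edge-at a b rewrite dec-true (a ≟ a) refl | dec-true (b ≟ b) refl = refl

edge-ends : ∀ {m n} {a i : Fin m} {b j : Fin n} → edge a b i j ≡ true → i ≡ a × j ≡ b
edge-ends {a = a} {i} {b} {j} e with i ≟ a | j ≟ b
... | yes i≡a | yes j≡b = i≡a , j≡b
... | no  _   | _       with () ← e
... | yes _   | no _    with () ← e

lowerAt-off : ∀ {n} {a i : Fin n} (f : Fin n → ℕ) → i ≢ a → lowerAt a f i ≡ f i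
lowerAt-off {a = a} {i} f i≢a rewrite dec-false (i ≟ a) i≢a = refl

lowerAt-at : ∀ {n} (a : Fin n) (f : Fin n → ℕ) → 0 < f a → f a ≡ suc (lowerAt a f a)
lowerAt-at a f 0<fa rewrite dec-true (a ≟ a) refl = sym (m+[n∸m]≡n 0<fa)

removeEdge : ∀ {m n} → Graph m n → Fin m → Fin n → Graph m n
removeEdge G a b i j = G i j ∧ not (edge a b i j)

addEdge : ∀ {m n} → Graph m n → Fin m → Fin n → Graph m n
addEdge F a b i j = F i j ∨ edge a b i j

module RemoveEdge {m n} {G : Graph m n} {r : Fin m → ℕ} {c : Fin n → ℕ} {a : Fin m} {b : Fin n}
                  (Gab : G a b ≡ true) (0<ra : 0 < r a) (0<cb : 0 < c b) where

  G⁻ : Graph m n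
  G⁻ = removeEdge G a b

  r⁻ : Fin m → ℕ
  r⁻ = lowerAt a r

  c⁻ : Fin n → ℕ
  c⁻ = lowerAt b c

  G⁻-off-row : ∀ {i} j → i ≢ a → G⁻ i j ≡ G i j
  G⁻-off-row {i} j i≢a = trans (cong (λ e → G i j ∧ not e) (edge-off-row b j i≢a)) (∧-identityʳ (G i j))

  G⁻-off-column : ∀ i {j} → j ≢ b → G⁻ i j ≡ G i j
  G⁻-off-column i {j} j≢b = trans (cong (λ e → G i j ∧ not e) (edge-off-column a i j≢b)) (∧-identityʳ (G i j))

  G⁻-at : G⁻ a b ≡ false
  G⁻-at rewrite edge-at a b = ∧-zeroʳ (G a b)

  -- The total demand drops by one, so the induction hypothesis applies.
  total-drops : ∑ r ≡ suc (∑ r⁻)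
  total-drops = ∑-suc-at a r⁻ r (λ i → lowerAt-off r) (lowerAt-at a r 0<ra)

  nbrs-off-column : ∀ X {j} → j ≢ b → nbrs G⁻ X j ≡ nbrs G X j
  nbrs-off-column X j≢b = sum-cong-≗ λ i → cong (λ e → 𝟙 (lookup X i) * 𝟙 e) (G⁻-off-column i j≢b)

  through-a : ∀ X → lookup X a ≡ true →
              weight r X ≡ suc (weight r⁻ X) × supply G c X ≡ suc (supply G⁻ c⁻ X)
  through-a X Xa = demand , ∑-suc-at b _ _ off-b at-b
    where
    demand : weight r X ≡ suc (weight r⁻ X)
    demand = ∑-suc-at a (r⁻ ↾ X) (r ↾ X) (λ i i≢a → cong (𝟙 (lookup X i) *_) (lowerAt-off r i≢a))
      demand-at-a
      where
      demand-at-a : 𝟙 (lookup X a) * r a ≡ suc (𝟙 (lookup X a) * r⁻ a)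
      demand-at-a rewrite Xa =
        trans (*-identityˡ (r a)) (trans (lowerAt-at a r 0<ra) (cong suc (sym (*-identityˡ (r⁻ a)))))
    nbrs-at-b : nbrs G X b ≡ suc (nbrs G⁻ X b)
    nbrs-at-b = ∑-suc-at a _ _ (λ i i≢a → cong (λ e → 𝟙 (lookup X i) * 𝟙 e) (G⁻-off-row b i≢a)) edge-ab
      where
      edge-ab : 𝟙 (lookup X a) * 𝟙 (G a b) ≡ suc (𝟙 (lookup X a) * 𝟙 (G⁻ a b))
      edge-ab rewrite Xa | G⁻-at | Gab = refl
    off-b : ∀ j → j ≢ b → c⁻ j ⊓ nbrs G⁻ X j ≡ c j ⊓ nbrs G X j
    off-b j j≢b = cong₂ _⊓_ (lowerAt-off c j≢b) (nbrs-off-column X j≢b)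
    at-b : c b ⊓ nbrs G X b ≡ suc (c⁻ b ⊓ nbrs G⁻ X b)
    at-b = cong₂ _⊓_ (lowerAt-at b c 0<cb) nbrs-at-b

  avoiding-a : ∀ X → lookup X a ≡ false →
               weight r⁻ X ≡ weight r X × supply G c X ≤ suc (supply G⁻ c⁻ X)
  avoiding-a X Xa = sum-cong-≗ demand , ∑-≤-suc-at b _ _ off-b at-b
    where
    X∌a : ∀ w → 𝟙 (lookup X a) * w ≡ 0
    X∌a w rewrite Xa = refl
    demand : ∀ i → 𝟙 (lookup X i) * r⁻ i ≡ 𝟙 (lookup X i) * r i
    demand = at-or-off a (trans (X∌a (r⁻ a)) (sym (X∌a (r a))))
                         (λ i i≢a → cong (𝟙 (lookup X i) *_) (lowerAt-off r i≢a))
    same-nbrs : ∀ j → nbrs G⁻ X j ≡ nbrs G X j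
    same-nbrs j = sum-cong-≗ (at-or-off a (trans (X∌a (𝟙 (G⁻ a j))) (sym (X∌a (𝟙 (G a j)))))
                    λ i i≢a → cong (λ e → 𝟙 (lookup X i) * 𝟙 e) (G⁻-off-row j i≢a))
    off-b : ∀ j → j ≢ b → c⁻ j ⊓ nbrs G⁻ X j ≡ c j ⊓ nbrs G X j
    off-b j j≢b = cong₂ _⊓_ (lowerAt-off c j≢b) (same-nbrs j)
    at-b : c b ⊓ nbrs G X b ≤ suc (c⁻ b ⊓ nbrs G⁻ X b)
    at-b = ≤-trans (≤-reflexive (cong₂ _⊓_ (lowerAt-at b c 0<cb) (sym (same-nbrs b))))
                   (⊓-suc-≤ (c⁻ b) (nbrs G⁻ X b))
      where
      ⊓-suc-≤ : ∀ x y → suc x ⊓ y ≤ suc (x ⊓ y)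
      ⊓-suc-≤ x zero    = z≤n
      ⊓-suc-≤ x (suc y) = s≤s (⊓-monoʳ-≤ x (n≤1+n y))

  hall-removed : HallCondition G r c → (∀ X → ¬ Tight G r c X) → HallCondition G⁻ r⁻ c⁻
  hall-removed hall no-tight X with lookup X a in Xa
  ... | true  = let demand , supply-drops = through-a X Xa in
                s≤s⁻¹ (subst₂ _≤_ demand supply-drops (hall X))
  ... | false with avoiding-a X Xa | 0 <? weight r X
  ...   | demand-same , supply-drops | no rX≯0 =
          subst (_≤ _) (sym (trans demand-same (n≤0⇒n≡0 (≮⇒≥ rX≯0)))) z≤n
  ...   | demand-same , supply-drops | yes 0<rX =
          subst (_≤ _) (sym demand-same)
            (s≤s⁻¹ (≤-trans (≰⇒> (λ saturated → no-tight X (0<rX , rX<∑r , saturated))) supply-drops))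
    where
    rX<∑r : weight r X < ∑ r
    rX<∑r = ∑-mono-< (λ i → ≤-self (lookup X i) (r i)) a (subst (λ x → 𝟙 x * r a < r a) (sym Xa) 0<ra)

  factor-restored : Factor G⁻ r⁻ c⁻ → Factor G r c
  factor-restored F⁻ = record
    { graph  = F
    ; ⊆G     = F⊆G
    ; deg₁≡r = at-or-off a deg₁-at-a deg₁-off-a
    ; deg₂≤c = at-or-off b deg₂-at-b deg₂-off-b }
    where
    open Factor F⁻ renaming (graph to F⁻-graph; ⊆G to F⁻⊆G⁻)
    F : Graph m n
    F = addEdge F⁻-graph a b

    -- The reduced factor avoids ab, so adding ab raises the degrees of a and b by one.
    F⁻-at : F⁻-graph a b ≡ false
    F⁻-at with F⁻-graph a b in F⁻ab
    ... | false = refl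
    ... | true  with () ← trans (sym (F⁻⊆G⁻ a b F⁻ab)) G⁻-at

    F⊆G : ∀ i j → F i j ≡ true → G i j ≡ true
    F⊆G i j Fij with F⁻-graph i j in F⁻ij
    ... | true  = ∧-true-left (F⁻⊆G⁻ i j F⁻ij)
      where
      ∧-true-left : ∀ {x y} → (x ∧ y) ≡ true → x ≡ true
      ∧-true-left {true} _ = refl
    ... | false with refl , refl ← edge-ends {i = i} {j = j} Fij = Gab

    F-at : 𝟙 (F a b) ≡ suc (𝟙 (F⁻-graph a b))
    F-at rewrite F⁻-at | edge-at a b = refl

    F-off-row : ∀ {i} j → i ≢ a → F i j ≡ F⁻-graph i j
    F-off-row {i} j i≢a = trans (cong (F⁻-graph i j ∨_) (edge-off-row b j i≢a)) (∨-identityʳ _)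

    F-off-column : ∀ i {j} → j ≢ b → F i j ≡ F⁻-graph i j
    F-off-column i j≢b = trans (cong (F⁻-graph i _ ∨_) (edge-off-column a i j≢b)) (∨-identityʳ _)

    deg₁-at-a : deg₁ F a ≡ r a
    deg₁-at-a = begin
      deg₁ F a           ≡⟨ ∑-suc-at b _ _ (λ j j≢b → cong 𝟙 (sym (F-off-column a j≢b))) F-at ⟩
      suc (deg₁ F⁻-graph a) ≡⟨ cong suc (deg₁≡r a) ⟩
      suc (r⁻ a)         ≡⟨ lowerAt-at a r 0<ra ⟨
      r a                ∎
      where open ≡-Reasoning

    deg₁-off-a : ∀ i → i ≢ a → deg₁ F i ≡ r i
    deg₁-off-a i i≢a = trans (sum-cong-≗ λ j → cong 𝟙 (F-off-row j i≢a))
                             (trans (deg₁≡r i) (lowerAt-off r i≢a))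

    deg₂-at-b : deg₂ F b ≤ c b
    deg₂-at-b = begin
      deg₂ F b              ≡⟨ ∑-suc-at a _ _ (λ i i≢a → cong 𝟙 (sym (F-off-row b i≢a))) F-at ⟩
      suc (deg₂ F⁻-graph b) ≤⟨ s≤s (deg₂≤c b) ⟩
      suc (c⁻ b)            ≡⟨ lowerAt-at b c 0<cb ⟨
      c b                   ∎
      where open ≤-Reasoning

    deg₂-off-b : ∀ j → j ≢ b → deg₂ F j ≤ c j
    deg₂-off-b j j≢b = subst₂ _≤_ (sum-cong-≗ λ i → cong 𝟙 (sym (F-off-column i j≢b)))
                                  (lowerAt-off c j≢b) (deg₂≤c j)

empty-factor : ∀ {m n} {G : Graph m n} {r c} → (∀ a → r a ≡ 0) → Factor G r c
empty-factor {m} {n} r≡0 = record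
  { graph  = λ _ _ → false
  ; ⊆G     = λ _ _ ()
  ; deg₁≡r = λ a → trans (sum-replicate-zero n) (sym (r≡0 a))
  ; deg₂≤c = λ b → ≤-trans (≤-reflexive (sum-replicate-zero m)) z≤n }

hall-step : ∀ {m n} {G : Graph m n} {r c} → HallBelow m n (∑ r) → HallCondition G r c → Factor G r c
hall-step {G = G} {r} {c} hall-below hall with Fin.any? (λ a → 0 <? r a)
... | no no-demand = empty-factor (λ a → n≤0⇒n≡0 (≮⇒≥ λ 0<ra → no-demand (a , 0<ra)))
... | yes (a , 0<ra) with anySubset? (tight? G r c)
...   | yes (X , tight) = split-at-tight X hall-below hall tight
...   | no  no-tight    with hall-neighbour {G = G} {r} {c} hall a 0<ra
...     | b , Gab , 0<cb =
          factor-restored (hall-below G⁻ r⁻ c⁻ (subst (∑ r⁻ <_) (sym total-drops) ≤-refl)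
                                      (hall-removed hall λ X tight → no-tight (X , tight)))
  where open RemoveEdge {G = G} {r} {c} {a} {b} Gab 0<ra 0<cb

hall-theorem : ∀ {m n} {G : Graph m n} {r c} → HallCondition G r c → Factor G r c
hall-theorem {m} {n} {G} {r} {c} = <-rec Goal step (∑ r) G r c refl
  where
  Goal : ℕ → Set
  Goal t = ∀ (G : Graph m n) r c → ∑ r ≡ t → HallCondition G r c → Factor G r c
  step : ∀ t → (∀ {s} → s < t → Goal s) → Goal t
  step t ih G r c refl = hall-step (λ G' r' c' r'<r → ih r'<r G' r' c' refl)

sum-as-∑ : ∀ {n} (h : Fin n → ℕ) → listSum (List.map h (allFin n)) ≡ ∑ h
sum-as-∑ h = trans (cong listSum (map-tabulate (λ i → i) h)) (tabulated h)
  where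
  tabulated : ∀ {n} (h : Fin n → ℕ) → listSum (List.tabulate h) ≡ ∑ h
  tabulated {zero}  h = refl
  tabulated {suc n} h = cong (h zero +_) (tabulated (h ∘ suc))

e-rows : ∀ {n} (G : BipGraph n) X Y → e G X Y ≡ weight (λ a → weight (λ b → 𝟙 (G a b)) Y) X
e-rows {n} G X Y = trans (sum-as-∑ (λ a → listSum (List.map (entry a) (allFin n)))) (sum-cong-≗ λ a → begin
  listSum (List.map (entry a) (allFin n))                    ≡⟨ sum-as-∑ (entry a) ⟩
  ∑ (entry a)
    ≡⟨ sum-cong-≗ (λ b → bracket (lookup X a) (lookup Y b) (G a b)) ⟩
  ∑ (λ b → 𝟙 (lookup X a) * (𝟙 (lookup Y b) * 𝟙 (G a b)))
    ≡⟨ *-distribˡ-sum (𝟙 (lookup X a)) (λ b → 𝟙 (lookup Y b) * 𝟙 (G a b)) ⟨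
  𝟙 (lookup X a) * weight (λ b → 𝟙 (G a b)) Y ∎)
  where
  open ≡-Reasoning
  entry : Fin n → Fin n → ℕ
  entry a b = if lookup X a ∧ lookup Y b ∧ G a b then 1 else 0
  bracket : ∀ x y g → (if x ∧ y ∧ g then 1 else 0) ≡ 𝟙 x * (𝟙 y * 𝟙 g)
  bracket false y     g     = refl
  bracket true  false g     = refl
  bracket true  true  false = refl
  bracket true  true  true  = refl

e-columns : ∀ {n} (G : BipGraph n) X Y → e G X Y ≡ weight (nbrs G X) Y
e-columns G X Y = trans (e-rows G X Y) (weight-swap (λ a b → 𝟙 (G a b)) X Y)

_ᵀ : ∀ {n} → BipGraph n → BipGraph n
(G ᵀ) b a = G a b

e-transpose : ∀ {n} (G : BipGraph n) X Y → e (G ᵀ) Y X ≡ e G X Y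
e-transpose G X Y = trans (e-rows (G ᵀ) Y X) (sym (e-columns G X Y))

∣∣-split : ∀ {n} (W D : Subset n) → ∣ W ∣ ≡ ∣ W ∩ D ∣ + ∣ W ∩ ∁ D ∣
∣∣-split W D = begin
  ∣ W ∣                                                   ≡⟨ as-weight W ⟩
  weight (λ _ → 1) W                                       ≡⟨ weight-split (λ _ → 1) W D ⟩
  weight (λ _ → 1) (W ∩ D) + weight (λ _ → 1) (W ∩ ∁ D)   ≡⟨ cong₂ _+_ (as-weight (W ∩ D)) (as-weight (W ∩ ∁ D)) ⟨
  ∣ W ∩ D ∣ + ∣ W ∩ ∁ D ∣                                 ∎
  where
  open ≡-Reasoning
  as-weight : ∀ X → ∣ X ∣ ≡ weight (λ _ → 1) X
  as-weight X = sym (trans (weight-const 1 X) (*-identityˡ ∣ X ∣))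

e-split : ∀ {n} (G : BipGraph n) X W D → e G X W ≡ e G X (W ∩ D) + e G X (W ∩ ∁ D)
e-split G X W D rewrite e-columns G X W | e-columns G X (W ∩ D) | e-columns G X (W ∩ ∁ D) =
  weight-split (nbrs G X) W D

∣∣+∣∁∣ : ∀ {n} (X : Subset n) → ∣ X ∣ + ∣ ∁ X ∣ ≡ n
∣∣+∣∁∣ X = trans (cong (∣ X ∣ +_) (∣∁p∣≡n∸∣p∣ X)) (m+[n∸m]≡n (∣p∣≤n X))

e-degree-sum : ∀ {n} (G : BipGraph n) X Y → e G X Y + e G X (∁ Y) ≡ weight (degA G) X
e-degree-sum G X Y = begin
  e G X Y + e G X (∁ Y)                                    ≡⟨ cong₂ _+_ (e-rows G X Y) (e-rows G X (∁ Y)) ⟩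
  weight (λ a → row a Y) X + weight (λ a → row a (∁ Y)) X   ≡⟨ weight-+ (λ a → row a Y) (λ a → row a (∁ Y)) X ⟨
  weight (λ a → row a Y + row a (∁ Y)) X                   ≡⟨ sum-cong-≗ (λ a → cong (𝟙 (lookup X a) *_) (degree a)) ⟩
  weight (degA G) X                                        ∎
  where
  open ≡-Reasoning
  row : _ → Subset _ → ℕ
  row a = weight (λ b → 𝟙 (G a b))
  degree : ∀ a → row a Y + row a (∁ Y) ≡ degA G a
  degree a = trans (weight-complement (λ b → 𝟙 (G a b)) Y) (sym (∣tabulate∣ (G a)))

e-≤-Δ : ∀ {n} (G : BipGraph n) Δ → (∀ b → degB G b ≤ Δ) → ∀ X W → e G X W ≤ Δ * ∣ W ∣
e-≤-Δ G Δ degB≤Δ X W = begin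
  e G X W               ≡⟨ e-columns G X W ⟩
  weight (nbrs G X) W   ≤⟨ weight-mono nbrs≤Δ W ⟩
  weight (λ _ → Δ) W    ≡⟨ weight-const Δ W ⟩
  Δ * ∣ W ∣             ∎
  where
  open ≤-Reasoning
  nbrs≤Δ : ∀ b → nbrs G X b ≤ Δ
  nbrs≤Δ b = ≤-trans (weight-≤-∑ (λ a → 𝟙 (G a b)) X)
                     (subst (_≤ Δ) (∣tabulate∣ (λ a → G a b)) (degB≤Δ b))

subset-of-size : ∀ {n} (W : Subset n) s → s ≤ ∣ W ∣ → ∃ λ D → ∣ W ∩ D ∣ ≡ s
subset-of-size []          zero    _   = [] , refl
subset-of-size (true ∷ W)  zero    _   = let D , size = subset-of-size W zero z≤n in false ∷ D , size
subset-of-size (true ∷ W)  (suc s) s≤W = let D , size = subset-of-size W s (s≤s⁻¹ s≤W) in true ∷ D , cong suc size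
subset-of-size (false ∷ W) s       s≤W = let D , size = subset-of-size W s s≤W in false ∷ D , size

DenseLowerBound : ∀ {n} → BipGraph n → ℕ → ℕ → Set
DenseLowerBound {n} G k t =
  ∀ X Y → n ≤ t * ∣ X ∣ → n ≤ t * ∣ Y ∣ → k * ∣ X ∣ * ∣ Y ∣ ≤ n * e G X Y

-- Condition (ii), with 1/t in place of 1/140: pairs of sets of size at most n/t whose sizes
-- are within the factor D = (Δ-k)/(δ-k) of each other span at most k·min(|X|,|Y|) edges.
SparseUpperBound : ∀ {n} → BipGraph n → ℕ → ℕ → ℕ → ℕ → Set
SparseUpperBound {n} G k δ Δ t =
  ∀ X Y → t * ∣ X ∣ ≤ n → t * ∣ Y ∣ ≤ n →
  (δ ∸ k) * ∣ Y ∣ ≤ (Δ ∸ k) * ∣ X ∣ → (δ ∸ k) * ∣ X ∣ ≤ (Δ ∸ k) * ∣ Y ∣ →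
  e G X Y ≤ (∣ X ∣ ⊓ ∣ Y ∣) * k

sparse-transpose : ∀ {n} {G : BipGraph n} {k δ Δ t} →
                   SparseUpperBound G k δ Δ t → SparseUpperBound (G ᵀ) k δ Δ t
sparse-transpose {G = G} {k} sparse X Y tX≤n tY≤n Y≲X X≲Y =
  subst₂ _≤_ (sym (e-transpose G Y X)) (cong (_* k) (⊓-comm (∣ Y ∣) (∣ X ∣))) (sparse Y X tY≤n tX≤n X≲Y Y≲X)

Deficiency : ∀ {n} → BipGraph n → ℕ → Set
Deficiency G k = ∀ X Y → k * ∣ X ∣ ≤ e G X Y + k * ∣ ∁ Y ∣

module SmallSets {n} (H : BipGraph n) {k δ Δ t : ℕ} (k≤δ : k ≤ δ) (δ≤Δ : δ ≤ Δ)
                 (δ≤degA : ∀ a → δ ≤ degA H a) (degB≤Δ : ∀ b → degB H b ≤ Δ)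
                 (sparse : SparseUpperBound H k δ Δ t) where

  sparse-pair : ∀ X C → t * ∣ X ∣ ≤ n → ∣ C ∣ ≤ ∣ X ∣ → (δ ∸ k) * ∣ X ∣ ≤ (Δ ∸ k) * ∣ C ∣ →
                e H X C ≤ k * ∣ C ∣
  sparse-pair X C tX≤n C≤X X≲C = begin
    e H X C               ≤⟨ sparse X C tX≤n (≤-trans (*-monoʳ-≤ t C≤X) tX≤n)
                                   (*-mono-≤ (∸-monoˡ-≤ k δ≤Δ) C≤X) X≲C ⟩
    (∣ X ∣ ⊓ ∣ C ∣) * k   ≤⟨ *-monoˡ-≤ k (m⊓n≤n (∣ X ∣) (∣ C ∣)) ⟩
    ∣ C ∣ * k             ≡⟨ *-comm ∣ C ∣ k ⟩
    k * ∣ C ∣             ∎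
    where open ≤-Reasoning

  -- Targets W smaller than X: either (ii) applies, or the maximum degree bound suffices.
  few-targets : ∀ X W → t * ∣ X ∣ ≤ n → ∣ W ∣ < ∣ X ∣ →
                e H X W ≤ (δ ∸ k) * ∣ X ∣ + k * ∣ W ∣
  few-targets X W tX≤n W<X with (δ ∸ k) * ∣ X ∣ ≤? (Δ ∸ k) * ∣ W ∣
  ... | yes X≲W = ≤-trans (sparse-pair X W tX≤n (<⇒≤ W<X) X≲W) (m≤n+m _ _)
  ... | no  X≴W = begin
    e H X W                           ≤⟨ e-≤-Δ H Δ degB≤Δ X W ⟩
    Δ * ∣ W ∣                         ≡⟨ cong (_* ∣ W ∣) (m∸n+n≡m (≤-trans k≤δ δ≤Δ)) ⟨
    (Δ ∸ k + k) * ∣ W ∣               ≡⟨ *-distribʳ-+ ∣ W ∣ (Δ ∸ k) k ⟩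
    (Δ ∸ k) * ∣ W ∣ + k * ∣ W ∣       ≤⟨ +-monoˡ-≤ (k * ∣ W ∣) (<⇒≤ (≰⇒> X≴W)) ⟩
    (δ ∸ k) * ∣ X ∣ + k * ∣ W ∣       ∎
    where open ≤-Reasoning

  -- A small nonempty X sends at most (δ-k)|X| + k|W| edges into any W: peel off pieces of W
  -- of size |X|, each receiving at most k|X| edges, until fewer than |X| targets remain.
  small-set-edges : ∀ X W → t * ∣ X ∣ ≤ n → 0 < ∣ X ∣ → e H X W ≤ (δ ∸ k) * ∣ X ∣ + k * ∣ W ∣
  small-set-edges X W tX≤n 0<X = <-rec Goal step ∣ W ∣ W refl
    where
    Goal : ℕ → Set
    Goal s = ∀ W → ∣ W ∣ ≡ s → e H X W ≤ (δ ∸ k) * ∣ X ∣ + k * ∣ W ∣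
    step : ∀ s → (∀ {s'} → s' < s → Goal s') → Goal s
    step _ ih W refl with ∣ W ∣ <? ∣ X ∣
    ... | yes W<X = few-targets X W tX≤n W<X
    ... | no  W≮X = let D , C≡X = subset-of-size W ∣ X ∣ (≮⇒≥ W≮X) in begin
      e H X W                                    ≡⟨ e-split H X W D ⟩
      e H X (W ∩ D) + e H X (W ∩ ∁ D)            ≤⟨ +-mono-≤ (piece D C≡X) (rest D C≡X) ⟩
      k * ∣ W ∩ D ∣ + ((δ ∸ k) * ∣ X ∣ + k * ∣ W ∩ ∁ D ∣)
                                                 ≡⟨ regroup k (∣ W ∩ D ∣) ((δ ∸ k) * ∣ X ∣) (∣ W ∩ ∁ D ∣) ⟩
      (δ ∸ k) * ∣ X ∣ + k * (∣ W ∩ D ∣ + ∣ W ∩ ∁ D ∣)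
                                                 ≡⟨ cong (λ w → (δ ∸ k) * ∣ X ∣ + k * w) (∣∣-split W D) ⟨
      (δ ∸ k) * ∣ X ∣ + k * ∣ W ∣                ∎
      where
      open ≤-Reasoning
      regroup : ∀ k c s r → k * c + (s + k * r) ≡ s + k * (c + r)
      regroup = solve-∀
      piece : ∀ D → ∣ W ∩ D ∣ ≡ ∣ X ∣ → e H X (W ∩ D) ≤ k * ∣ W ∩ D ∣
      piece D C≡X = sparse-pair X (W ∩ D) tX≤n (≤-reflexive C≡X)
                      (≤-trans (*-monoˡ-≤ ∣ X ∣ (∸-monoˡ-≤ k δ≤Δ)) (≤-reflexive (cong ((Δ ∸ k) *_) (sym C≡X))))
      rest : ∀ D → ∣ W ∩ D ∣ ≡ ∣ X ∣ → e H X (W ∩ ∁ D) ≤ (δ ∸ k) * ∣ X ∣ + k * ∣ W ∩ ∁ D ∣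
      rest D C≡X = ih (subst (∣ W ∩ ∁ D ∣ <_) (sym (∣∣-split W D))
                             (m<n+m ∣ W ∩ ∁ D ∣ (subst (0 <_) (sym C≡X) 0<X)))
                      (W ∩ ∁ D) refl

  -- Small sets satisfy the deficiency bound: δ|X| ≤ e(X,Y) + e(X,∁Y), and the second term
  -- exceeds k|∁Y| by at most (δ-k)|X|.
  small-deficiency : ∀ X Y → t * ∣ X ∣ ≤ n → k * ∣ X ∣ ≤ e H X Y + k * ∣ ∁ Y ∣
  small-deficiency X Y tX≤n with 0 <? ∣ X ∣
  ... | no  X≯0 rewrite n≤0⇒n≡0 (≮⇒≥ X≯0) | *-zeroʳ k = z≤n
  ... | yes 0<X = shed-excess {∣ X ∣} {e H X Y} {k * ∣ ∁ Y ∣} (begin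
    δ * ∣ X ∣                               ≡⟨ weight-const δ X ⟨
    weight (λ _ → δ) X                      ≤⟨ weight-mono δ≤degA X ⟩
    weight (degA H) X                       ≡⟨ e-degree-sum H X Y ⟨
    e H X Y + e H X (∁ Y)                   ≤⟨ +-monoʳ-≤ (e H X Y) (small-set-edges X (∁ Y) tX≤n 0<X) ⟩
    e H X Y + ((δ ∸ k) * ∣ X ∣ + k * ∣ ∁ Y ∣) ∎)
    where
    open ≤-Reasoning
    shed-excess : ∀ {x E K} → δ * x ≤ E + ((δ ∸ k) * x + K) → k * x ≤ E + K
    shed-excess {x} {E} {K} δx≤ = +-cancelʳ-≤ ((δ ∸ k) * x) (k * x) (E + K) (begin
      k * x + (δ ∸ k) * x       ≡⟨ *-distribʳ-+ x k (δ ∸ k) ⟨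
      (k + (δ ∸ k)) * x         ≡⟨ cong (_* x) (m+[n∸m]≡n k≤δ) ⟩
      δ * x                     ≤⟨ δx≤ ⟩
      E + ((δ ∸ k) * x + K)     ≡⟨ rearrange E ((δ ∸ k) * x) K ⟩
      E + K + (δ ∸ k) * x       ∎)
      where
      rearrange : ∀ a b c → a + (b + c) ≡ a + c + b
      rearrange = solve-∀

-- The deficiency bound is symmetric in X and Y: since |X| + |∁X| = |Y| + |∁Y|,
-- k|Y| ≤ E + k|∁X| implies k|X| ≤ E + k|∁Y|.
deficiency-swap : ∀ {n} k (X Y : Subset n) E → k * ∣ Y ∣ ≤ E + k * ∣ ∁ X ∣ → k * ∣ X ∣ ≤ E + k * ∣ ∁ Y ∣
deficiency-swap k X Y E kY≤ = +-cancelʳ-≤ (k * ∣ ∁ X ∣) (k * ∣ X ∣) (E + k * ∣ ∁ Y ∣) (begin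
  k * ∣ X ∣ + k * ∣ ∁ X ∣          ≡⟨ *-distribˡ-+ k (∣ X ∣) (∣ ∁ X ∣) ⟨
  k * (∣ X ∣ + ∣ ∁ X ∣)            ≡⟨ cong (k *_) (trans (∣∣+∣∁∣ X) (sym (∣∣+∣∁∣ Y))) ⟩
  k * (∣ Y ∣ + ∣ ∁ Y ∣)            ≡⟨ *-distribˡ-+ k (∣ Y ∣) (∣ ∁ Y ∣) ⟩
  k * ∣ Y ∣ + k * ∣ ∁ Y ∣          ≤⟨ +-monoˡ-≤ (k * ∣ ∁ Y ∣) kY≤ ⟩
  E + k * ∣ ∁ X ∣ + k * ∣ ∁ Y ∣    ≡⟨ swap-last E (k * ∣ ∁ X ∣) (k * ∣ ∁ Y ∣) ⟩
  E + k * ∣ ∁ Y ∣ + k * ∣ ∁ X ∣    ∎)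
  where
  open ≤-Reasoning
  swap-last : ∀ a b c → a + b + c ≡ a + c + b
  swap-last = solve-∀

-- Dense pairs satisfy the deficiency bound: multiply through by n = |Y| + |∁Y| and use |X| ≤ n.
dense-deficiency : ∀ {n} k (X Y : Subset n) E → k * ∣ X ∣ * ∣ Y ∣ ≤ n * E → k * ∣ X ∣ ≤ E + k * ∣ ∁ Y ∣
dense-deficiency {zero} k X Y E _ rewrite n≤0⇒n≡0 (∣p∣≤n X) | *-zeroʳ k = z≤n
dense-deficiency {n@(suc _)} k X Y E kXY≤nE = *-cancelˡ-≤ n (begin
  n * (k * ∣ X ∣)                          ≡⟨ cong (_* (k * ∣ X ∣)) (∣∣+∣∁∣ Y) ⟨
  (∣ Y ∣ + ∣ ∁ Y ∣) * (k * ∣ X ∣)          ≡⟨ expand k (∣ X ∣) (∣ Y ∣) (∣ ∁ Y ∣) ⟩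
  k * ∣ X ∣ * ∣ Y ∣ + ∣ ∁ Y ∣ * (k * ∣ X ∣) ≤⟨ +-mono-≤ kXY≤nE (*-monoʳ-≤ (∣ ∁ Y ∣) (*-monoʳ-≤ k (∣p∣≤n X))) ⟩
  n * E + ∣ ∁ Y ∣ * (k * n)                ≡⟨ collect n E k (∣ ∁ Y ∣) ⟩
  n * (E + k * ∣ ∁ Y ∣)                    ∎)
  where
  open ≤-Reasoning
  expand : ∀ k x y y' → (y + y') * (k * x) ≡ k * x * y + y' * (k * x)
  expand = solve-∀
  collect : ∀ n E k y' → n * E + y' * (k * n) ≡ n * (E + k * y')
  collect = solve-∀

-- Conditions (i) and (ii), together with k ≤ δ ≤ Δ, give the deficiency bound for all pairs:
-- directly if X and Y are both large, by the small-set bound if X is small, and by the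
-- small-set bound in the transposed graph if Y is small.
deficiency : ∀ {n} {G : BipGraph n} {k δ Δ t} → k ≤ δ → δ ≤ Δ →
             (∀ a → δ ≤ degA G a) → (∀ b → δ ≤ degB G b) →
             (∀ a → degA G a ≤ Δ) → (∀ b → degB G b ≤ Δ) →
             DenseLowerBound G k t → SparseUpperBound G k δ Δ t → Deficiency G k
deficiency {n} {G} {k} {t = t} k≤δ δ≤Δ δ≤degA δ≤degB degA≤Δ degB≤Δ dense sparse X Y
  with n ≤? t * ∣ X ∣ | n ≤? t * ∣ Y ∣
... | yes X-large | yes Y-large = dense-deficiency k X Y (e G X Y) (dense X Y X-large Y-large)
... | no  X-small | _           = small-deficiency X Y (<⇒≤ (≰⇒> X-small))
  where open SmallSets G {t = t} k≤δ δ≤Δ δ≤degA degB≤Δ sparse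
... | yes _       | no Y-small  = deficiency-swap k X Y (e G X Y)
  (subst (λ E → k * ∣ Y ∣ ≤ E + k * ∣ ∁ X ∣) (e-transpose G X Y) (small-deficiency Y X (<⇒≤ (≰⇒> Y-small))))
  where open SmallSets (G ᵀ) {t = t} k≤δ δ≤Δ δ≤degB degA≤Δ (sparse-transpose {G = G} {t = t} sparse)

-- The deficiency bound is Hall's condition for demand and capacity k: the supply of X equals
-- e(X,Y) + k|∁Y| for Y the set of vertices with fewer than k neighbours in X.
hall-from-deficiency : ∀ {n} {G : BipGraph n} {k} → Deficiency G k → HallCondition G (λ _ → k) (λ _ → k)
hall-from-deficiency {n} {G} {k} deficient X = begin
  weight (λ _ → k) X                                  ≡⟨ weight-const k X ⟩
  k * ∣ X ∣                                            ≤⟨ deficient X Y ⟩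
  e G X Y + k * ∣ ∁ Y ∣                                ≡⟨ cong₂ _+_ (sym (e-columns G X Y)) (weight-const k (∁ Y)) ⟨
  weight (nbrs G X) Y + weight (λ _ → k) (∁ Y)         ≡⟨ ∑-distrib-+ (nbrs G X ↾ Y) ((λ _ → k) ↾ ∁ Y) ⟨
  ∑ (λ b → (nbrs G X ↾ Y) b + ((λ _ → k) ↾ ∁ Y) b)     ≡⟨ sum-cong-≗ min-split ⟨
  supply G (λ _ → k) X                                 ∎
  where
  open ≤-Reasoning
  Y : Subset n
  Y = tabulate (λ b → does (nbrs G X b <? k))
  min-split : ∀ b → k ⊓ nbrs G X b ≡ (nbrs G X ↾ Y) b + ((λ _ → k) ↾ ∁ Y) b
  min-split b rewrite lookup-∁ Y b | lookup∘tabulate (λ b → does (nbrs G X b <? k)) b =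
    choice (nbrs G X b <? k)
    where
    d = nbrs G X b
    choice : (d<?k : Dec (d < k)) → k ⊓ d ≡ 𝟙 (does d<?k) * d + 𝟙 (not (does d<?k)) * k
    choice (yes d<k) = trans (m≥n⇒m⊓n≡n (<⇒≤ d<k)) (sym (trans (+-identityʳ _) (*-identityˡ d)))
    choice (no  d≮k) = trans (m≤n⇒m⊓n≡m (≮⇒≥ d≮k)) (sym (*-identityˡ k))

regular-right : ∀ {n} (F : Graph n n) k → (∀ a → deg₁ F a ≡ k) → (∀ b → deg₂ F b ≤ k) →
                ∀ b → deg₂ F b ≡ k
regular-right {n} F k deg₁≡k deg₂≤k = ∑-rigid deg₂≤k (begin
  ∑ {n} (λ _ → k)  ≡⟨ sum-cong-≗ deg₁≡k ⟨
  ∑ (deg₁ F)       ≡⟨ ∑-comm (λ a b → 𝟙 (F a b)) ⟩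
  ∑ (deg₂ F)       ∎)
  where open ≤-Reasoning

-- The minimum degree is attained, so it is at most the maximum degree.
min≤max : ∀ {n} {G : BipGraph n} {δ Δ} → IsMinDegree G δ → IsMaxDegree G Δ → δ ≤ Δ
min≤max (δ≤degA , _      , inj₁ (a , _)) (degA≤Δ , _      , _) = ≤-trans (δ≤degA a) (degA≤Δ a)
min≤max (_      , δ≤degB , inj₂ (b , _)) (_      , degB≤Δ , _) = ≤-trans (δ≤degB b) (degB≤Δ b)

lemma2p3 : (n : ℕ) (G : BipGraph n) (k δ Δ : ℕ) →
    IsMinDegree G δ → IsMaxDegree G Δ → k < δ →
    ((X Y : Subset n) → n ≤ 140 * ∣ X ∣ → n ≤ 140 * ∣ Y ∣ →
      k * ∣ X ∣ * ∣ Y ∣ ≤ n * e G X Y) →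
    ((X Y : Subset n) → 140 * ∣ X ∣ ≤ n → 140 * ∣ Y ∣ ≤ n →
      (δ ∸ k) * ∣ Y ∣ ≤ (Δ ∸ k) * ∣ X ∣ →
      (δ ∸ k) * ∣ X ∣ ≤ (Δ ∸ k) * ∣ Y ∣ →
      e G X Y ≤ (∣ X ∣ ⊓ ∣ Y ∣) * k) →
    HasKFactor G k
lemma2p3 n G k δ Δ min@(δ≤degA , δ≤degB , _) max@(degA≤Δ , degB≤Δ , _) k<δ dense sparse =
  graph , ⊆G ,
  (λ a → trans (∣tabulate∣ (graph a)) (deg₁≡r a)) ,
  (λ b → trans (∣tabulate∣ (λ a → graph a b)) (regular-right graph k deg₁≡r deg₂≤c b))
  where
  open Factor (hall-theorem {G = G} (hall-from-deficiency {G = G} {k}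
    (deficiency {G = G} {t = 140} (<⇒≤ k<δ) (min≤max min max) δ≤degA δ≤degB degA≤Δ degB≤Δ dense sparse)))
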